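{- For every integer $a\ge 2$, $\alpha(C(2a;1,a))=a$ if $a$ is odd, and $\alpha(C(2a;1,a))=a-1$ if $a$ is even.
   Context: For integers $n\ge 3$ and $1\le a\le\lfloor n/2\rfloor$, the circulant graph $C(n;1,a)$ has vertex set $\{v_0,\dots,v_{n-1}\}$ and edges $v_iv_{i+1}$ and $v_iv_{i+a}$, subscripts modulo $n$. $\alpha(G)$ denotes the independence number of $G$. -}

module Defs where

open import Data.Nat using (ℕ; zero; suc; _+_; _%_)
open import Data.Fin using (Fin; toℕ)
open import Data.Fin.Subset using (Subset; _∈_; ∣_∣)
open import Data.Sum using (_⊎_)
open import Data.Empty using (⊥)
open import Data.Product using (Σ; _×_)
open import Relation.Binary.PropositionalEquality using (_≡_)
open import Data.Nat using (_≤_)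

-- Residue modulo n (n = 0 never arises: there Fin n is empty).
_mod_ : ℕ → ℕ → ℕ
m mod zero = m
m mod suc k = m % suc k

CircStep : (n a : ℕ) → Fin n → Fin n → Set
CircStep n a i j = (toℕ j ≡ (toℕ i + 1) mod n) ⊎ (toℕ j ≡ (toℕ i + a) mod n)

CircAdj : (n a : ℕ) → Fin n → Fin n → Set
CircAdj n a i j = CircStep n a i j ⊎ CircStep n a j i

IsIndependent : (n a : ℕ) → Subset n → Set
IsIndependent n a S = ∀ i j → i ∈ S → j ∈ S → CircAdj n a i j → ⊥

IndependenceNumber : (n a : ℕ) → ℕ → Set
IndependenceNumber n a k =
  Σ (Subset n) (λ S → IsIndependent n a S × ∣ S ∣ ≡ k)
  × (∀ (S : Subset n) → IsIndependent n a S → ∣ S ∣ ≤ k)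

-- Draw C(2a;1,a) as a Möbius ladder: two rails v_0 … v_{a-1} and v_a … v_{2a-1},
-- rungs v_k v_{a+k}, and two twisted edges v_{a-1} v_a and v_{2a-1} v_0.  An
-- independent set meets each rung at most once, so α ≤ a.  If it has size a it
-- meets every rung exactly once, and the path edges force consecutive rungs to be
-- met on opposite rails; the side therefore switches a-1 times along the ladder,
-- and the twisted edges allow this only when a-1 is even.  Conversely, choosing
-- alternate vertices on the rails gives a when a is odd, and for every a the same
-- pattern with v_a removed gives a-1.

module Submission where

open import Defs
open import Data.Bool using (Bool; true; false; not; _∧_; _∨_; _xor_; if_then_else_)
open import Data.Bool.Properties
  using (not-involutive; not-injective; not-distribˡ-xor;
         ∧-comm; ∧-zeroʳ; ∧-identityʳ; ∧-inverseˡ; ∧-inverseʳ)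
open import Data.Empty using (⊥; ⊥-elim)
open import Data.Fin using (Fin; toℕ; fromℕ<; zero; suc)
open import Data.Fin.Properties using (toℕ<n; toℕ-fromℕ<)
open import Data.Fin.Subset using (Subset; _∈_; ∣_∣)
open import Data.Nat
  using (ℕ; zero; suc; _+_; _*_; _∸_; _≤_; _<_; _%_; z≤n; s≤s; s≤s⁻¹; z<s; s<s; _<?_)
open import Data.Nat.DivMod using (m<n⇒m%n≡m; [m+n]%n≡m%n)
open import Data.Nat.Properties
open import Data.Product using (_×_; _,_)
open import Data.Sum using (_⊎_; inj₁; inj₂)
open import Data.Vec using (Vec; []; _∷_; _++_; lookup; tabulate)
open import Data.Vec.Properties using ([]=⇒lookup; lookup⇒[]=)
open import Function using (_∘_)
open import Relation.Nullary using (yes; no)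
open import Relation.Binary.PropositionalEquality
open ≡-Reasoning

Apart : Bool → Bool → Set
Apart x y = x ∧ y ≡ false

∧≡false⇒¬both : ∀ {x y} → x ∧ y ≡ false → x ≡ true → y ≡ true → ⊥
∧≡false⇒¬both () refl refl

∧≡false-∨≡true⇒≡not : ∀ {x y} → x ∧ y ≡ false → x ∨ y ≡ true → y ≡ not x
∧≡false-∨≡true⇒≡not {true} {false} _ _ = refl
∧≡false-∨≡true⇒≡not {false} {true} _ _ = refl

∧≡false-not∧not≡false⇒≡not : ∀ {x y} → x ∧ y ≡ false → not x ∧ not y ≡ false → y ≡ not x
∧≡false-not∧not≡false⇒≡not {true} {false} _ _ = refl
∧≡false-not∧not≡false⇒≡not {false} {true} _ _ = refl

parity : ℕ → Bool
parity zero = false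
parity (suc n) = not (parity n)

parity-%2 : ∀ n → parity n ≡ parity (n % 2)
parity-%2 zero = refl
parity-%2 (suc zero) = refl
parity-%2 (suc (suc n)) = begin
  not (not (parity n))  ≡⟨ not-involutive (parity n) ⟩
  parity n              ≡⟨ parity-%2 n ⟩
  parity (n % 2)        ≡⟨ cong parity (sym ([m+n]%n≡m%n n 2)) ⟩
  parity ((n + 2) % 2)  ≡⟨ cong (λ k → parity (k % 2)) (+-comm n 2) ⟩
  parity (suc (suc n) % 2) ∎

alternating : ∀ {f : ℕ → Bool} n → (∀ i → i < n → f (suc i) ≡ not (f i)) →
              f n ≡ parity n xor f 0
alternating zero _ = refl
alternating {f} (suc n) alt = begin
  f (suc n)               ≡⟨ alt n (n<1+n n) ⟩
  not (f n)               ≡⟨ cong not (alternating n (λ i i<n → alt i (m<n⇒m<1+n i<n))) ⟩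
  not (parity n xor f 0)  ≡⟨ not-distribˡ-xor (parity n) (f 0) ⟩
  parity (suc n) xor f 0  ∎

count : (ℕ → Bool) → ℕ → ℕ
count f zero = 0
count f (suc n) = if f 0 then suc (count (f ∘ suc) n) else count (f ∘ suc) n

count-cong : ∀ {f g} n → (∀ i → i < n → f i ≡ g i) → count f n ≡ count g n
count-cong zero _ = refl
count-cong {f} {g} (suc n) f≗g rewrite f≗g 0 z<s =
  cong (λ c → if g 0 then suc c else c) (count-cong n (λ i i<n → f≗g (suc i) (s<s i<n)))

count-+ : ∀ f m n → count f (m + n) ≡ count f m + count (λ k → f (m + k)) n
count-+ f zero n = refl
count-+ f (suc m) n with f 0
... | true = cong suc (count-+ (f ∘ suc) m n)
... | false = count-+ (f ∘ suc) m n

count≤ : ∀ f n → count f n ≤ n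
count≤ f zero = z≤n
count≤ f (suc n) with f 0
... | true = s≤s (count≤ (f ∘ suc) n)
... | false = m≤n⇒m≤1+n (count≤ (f ∘ suc) n)

count≡⇒true : ∀ f n → count f n ≡ n → ∀ i → i < n → f i ≡ true
count≡⇒true f (suc n) total i i<n with f 0 in f0
count≡⇒true f (suc n) total i i<n | false =
  ⊥-elim (<-irrefl refl (subst (_≤ n) total (count≤ (f ∘ suc) n)))
count≡⇒true f (suc n) total zero i<n | true = f0
count≡⇒true f (suc n) total (suc i) (s≤s i<n) | true =
  count≡⇒true (f ∘ suc) n (suc-injective total) i i<n

count-∨ : ∀ f g n → (∀ i → i < n → f i ∧ g i ≡ false) →
          count (λ i → f i ∨ g i) n ≡ count f n + count g n
count-∨ f g zero _ = refl
count-∨ f g (suc n) apart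
  with f 0 | g 0 | apart 0 z<s | count-∨ (f ∘ suc) (g ∘ suc) n (λ i i<n → apart (suc i) (s<s i<n))
... | true  | false | _ | ih = cong suc ih
... | false | true  | _ | ih = trans (cong suc ih) (sym (+-suc _ _))
... | false | false | _ | ih = ih

count-not : ∀ f n → count f n + count (not ∘ f) n ≡ n
count-not f zero = refl
count-not f (suc n) with f 0
... | true = cong suc (count-not (f ∘ suc) n)
... | false = trans (+-suc _ _) (cong suc (count-not (f ∘ suc) n))

_‼_ : ∀ {n} → Vec Bool n → ℕ → Bool
[] ‼ _ = false
(x ∷ _) ‼ zero = x
(_ ∷ xs) ‼ suc k = xs ‼ k

‼-toℕ : ∀ {n} (xs : Vec Bool n) (i : Fin n) → xs ‼ toℕ i ≡ lookup xs i
‼-toℕ (_ ∷ _) zero = refl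
‼-toℕ (_ ∷ xs) (suc i) = ‼-toℕ xs i

‼≡true⇒< : ∀ {n} (xs : Vec Bool n) k → xs ‼ k ≡ true → k < n
‼≡true⇒< (_ ∷ _) zero _ = z<s
‼≡true⇒< (_ ∷ xs) (suc k) xs‼k = s<s (‼≡true⇒< xs k xs‼k)

∈⇒‼≡true : ∀ {n} {S : Subset n} {i} → i ∈ S → S ‼ toℕ i ≡ true
∈⇒‼≡true {S = S} {i} i∈S = trans (‼-toℕ S i) ([]=⇒lookup i∈S)

‼≡true⇒∈ : ∀ {n} {S : Subset n} {k} (k<n : k < n) → S ‼ k ≡ true → fromℕ< k<n ∈ S
‼≡true⇒∈ {S = S} k<n S‼k =
  lookup⇒[]= _ S (trans (sym (‼-toℕ S _)) (trans (cong (S ‼_) (toℕ-fromℕ< k<n)) S‼k))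

‼-++ˡ : ∀ {m n} (xs : Vec Bool m) (ys : Vec Bool n) k → k < m → (xs ++ ys) ‼ k ≡ xs ‼ k
‼-++ˡ (_ ∷ _) ys zero _ = refl
‼-++ˡ (_ ∷ xs) ys (suc k) (s≤s k<m) = ‼-++ˡ xs ys k k<m

‼-++ʳ : ∀ {m n} (xs : Vec Bool m) (ys : Vec Bool n) k → (xs ++ ys) ‼ (m + k) ≡ ys ‼ k
‼-++ʳ [] ys k = refl
‼-++ʳ (_ ∷ xs) ys k = ‼-++ʳ xs ys k

‼-tabulate : ∀ {n} (f : ℕ → Bool) k → k < n → tabulate {n = n} (f ∘ toℕ) ‼ k ≡ f k
‼-tabulate {suc n} f zero _ = refl
‼-tabulate {suc n} f (suc k) (s≤s k<n) = ‼-tabulate (f ∘ suc) k k<n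

∣∣≡count : ∀ {n} (S : Subset n) → ∣ S ∣ ≡ count (S ‼_) n
∣∣≡count [] = refl
∣∣≡count (true ∷ S) = cong suc (∣∣≡count S)
∣∣≡count (false ∷ S) = ∣∣≡count S

Step : ℕ → ℕ → ℕ → ℕ → Set
Step n a i j = (j ≡ (i + 1) mod n) ⊎ (j ≡ (i + a) mod n)

independent⇒apart : ∀ {n a} {S : Subset n} → IsIndependent n a S →
                    ∀ i j → Step n a i j → S ‼ i ∧ S ‼ j ≡ false
independent⇒apart {n} {a} {S} ind i j step with S ‼ i in S‼i | S ‼ j in S‼j
... | false | _ = refl
... | true | false = refl
... | true | true = ⊥-elim (ind _ _ (‼≡true⇒∈ i<n S‼i) (‼≡true⇒∈ j<n S‼j)
        (inj₁ (subst₂ (Step n a) (sym (toℕ-fromℕ< i<n)) (sym (toℕ-fromℕ< j<n)) step)))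
  where
  i<n = ‼≡true⇒< S i S‼i
  j<n = ‼≡true⇒< S j S‼j

apart⇒independent : ∀ {n a} {S : Subset n} →
                    (∀ {i j} → i < n → Step n a i j → S ‼ i ∧ S ‼ j ≡ false) →
                    IsIndependent n a S
apart⇒independent apart i j i∈S j∈S (inj₁ step) =
  ∧≡false⇒¬both (apart (toℕ<n i) step) (∈⇒‼≡true i∈S) (∈⇒‼≡true j∈S)
apart⇒independent apart i j i∈S j∈S (inj₂ step) =
  ∧≡false⇒¬both (apart (toℕ<n j) step) (∈⇒‼≡true j∈S) (∈⇒‼≡true i∈S)

mod-id : ∀ {x y n} → x ≡ y → y < n → x mod n ≡ y
mod-id {n = suc _} refl y<n = m<n⇒m%n≡m y<n

mod-wrap : ∀ {x y n} → x ≡ y + n → y < n → x mod n ≡ y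
mod-wrap {y = y} {n = suc n} refl y<n = trans ([m+n]%n≡m%n y (suc n)) (m<n⇒m%n≡m y<n)

data RailPosition (a : ℕ) : ℕ → Set where
  lower : ∀ {k} → k < a → RailPosition a k
  upper : ∀ {k} → k < a → RailPosition a (a + k)

railPosition : ∀ {a i} → i < a + a → RailPosition a i
railPosition {a} {i} i<2a with i <? a
... | yes i<a = lower i<a
... | no i≮a = subst (RailPosition a) (m+[n∸m]≡n a≤i)
                 (upper (subst (i ∸ a <_) (m+n∸m≡n a a) (∸-monoˡ-< i<2a a≤i)))
  where a≤i = ≮⇒≥ i≮a

-- g and h are the rails v_0 … v_m and v_{m+1} … v_{2m+1} of C(2m+2;1,m+1), read
-- as subsets of {0 … m}.
record MöbiusIndependent (m : ℕ) (g h : ℕ → Bool) : Set where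
  field
    lower-path : ∀ i → i < m → g i ∧ g (suc i) ≡ false
    upper-path : ∀ i → i < m → h i ∧ h (suc i) ≡ false
    rung       : ∀ k → k < suc m → g k ∧ h k ≡ false
    twist₁     : g m ∧ h 0 ≡ false
    twist₂     : h m ∧ g 0 ≡ false

möbius-cong : ∀ {m g h g′ h′} →
              (∀ k → k < suc m → g k ≡ g′ k) → (∀ k → k < suc m → h k ≡ h′ k) →
              MöbiusIndependent m g h → MöbiusIndependent m g′ h′
möbius-cong {m} g≗g′ h≗h′ ind = record
  { lower-path = λ i i<m →
      subst₂ Apart (g≗g′ i (m<n⇒m<1+n i<m)) (g≗g′ (suc i) (s<s i<m)) (lower-path i i<m)
  ; upper-path = λ i i<m →
      subst₂ Apart (h≗h′ i (m<n⇒m<1+n i<m)) (h≗h′ (suc i) (s<s i<m)) (upper-path i i<m)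
  ; rung       = λ k k<a → subst₂ Apart (g≗g′ k k<a) (h≗h′ k k<a) (rung k k<a)
  ; twist₁     = subst₂ Apart (g≗g′ m (n<1+n m)) (h≗h′ 0 z<s) twist₁
  ; twist₂     = subst₂ Apart (h≗h′ m (n<1+n m)) (g≗g′ 0 z<s) twist₂
  }
  where open MöbiusIndependent ind

module _ {m : ℕ} {g h : ℕ → Bool} (ind : MöbiusIndependent m g h) where
  open MöbiusIndependent ind

  rails-count≤ : count g (suc m) + count h (suc m) ≤ suc m
  rails-count≤ = subst (_≤ suc m) (count-∨ g h (suc m) rung) (count≤ (λ k → g k ∨ h k) (suc m))

  rails-count≡⇒complementary : count g (suc m) + count h (suc m) ≡ suc m →
                               ∀ k → k < suc m → h k ≡ not (g k)
  rails-count≡⇒complementary total k k<a =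
    ∧≡false-∨≡true⇒≡not (rung k k<a)
      (count≡⇒true (λ k → g k ∨ h k) (suc m) (trans (count-∨ g h (suc m) rung) total) k k<a)

  complementary-rails⇒odd : (∀ k → k < suc m → h k ≡ not (g k)) → parity (suc m) ≡ true
  complementary-rails⇒odd h≡¬g with parity m in m-odd
  ... | false = refl
  ... | true = ⊥-elim (twists-clash (g 0)
                 (subst₂ Apart g-last (h≡¬g 0 z<s) twist₁)
                 (subst₂ Apart (trans (h≡¬g m (n<1+n m)) (cong not g-last)) refl twist₂))
    where
    alternates : ∀ i → i < m → g (suc i) ≡ not (g i)
    alternates i i<m = ∧≡false-not∧not≡false⇒≡not (lower-path i i<m)
      (subst₂ Apart (h≡¬g i (m<n⇒m<1+n i<m)) (h≡¬g (suc i) (s<s i<m)) (upper-path i i<m))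

    g-last : g m ≡ not (g 0)
    g-last = trans (alternating m alternates) (cong (_xor g 0) m-odd)

    twists-clash : ∀ x → not x ∧ not x ≡ false → not (not x) ∧ x ≡ false → ⊥
    twists-clash true _ ()
    twists-clash false () _

alternating-rails : ∀ {m} → parity (suc m) ≡ true → MöbiusIndependent m parity (not ∘ parity)
alternating-rails {m} a-odd = record
  { lower-path = λ i _ → ∧-inverseʳ (parity i)
  ; upper-path = λ i _ → ∧-inverseʳ (not (parity i))
  ; rung       = λ k _ → ∧-inverseʳ (parity k)
  ; twist₁     = trans (∧-identityʳ (parity m)) (not-injective a-odd)
  ; twist₂     = ∧-zeroʳ (not (parity m))
  }

positiveEven : ℕ → Bool
positiveEven zero = false
positiveEven (suc k) = parity k

positiveEven-rails : ∀ {m} → MöbiusIndependent m parity positiveEven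
positiveEven-rails {m} = record
  { lower-path = λ i _ → ∧-inverseʳ (parity i)
  ; upper-path = upper-path
  ; rung       = rung
  ; twist₁     = ∧-zeroʳ (parity m)
  ; twist₂     = ∧-zeroʳ (positiveEven m)
  }
  where
  upper-path : ∀ i → i < m → positiveEven i ∧ positiveEven (suc i) ≡ false
  upper-path zero _ = refl
  upper-path (suc i) _ = ∧-inverseʳ (parity i)

  rung : ∀ k → k < suc m → parity k ∧ positiveEven k ≡ false
  rung zero _ = refl
  rung (suc k) _ = ∧-inverseˡ (parity k)

count-parity-positiveEven : ∀ m → count parity (suc m) + count positiveEven (suc m) ≡ m
count-parity-positiveEven m = suc-injective (begin
  suc (count parity (suc m) + count parity m)
    ≡⟨ sym (+-suc _ _) ⟩
  count parity (suc m) + suc (count parity m)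
    ≡⟨ cong (λ c → count parity (suc m) + suc c) count-¬¬parity ⟩
  count parity (suc m) + count (not ∘ parity) (suc m)
    ≡⟨ count-not parity (suc m) ⟩
  suc m
    ∎)
  where
  count-¬¬parity : count parity m ≡ count (not ∘ not ∘ parity) m
  count-¬¬parity = count-cong m (λ k _ → sym (not-involutive (parity k)))

module _ (m : ℕ) where
  private
    a n : ℕ
    a = suc m
    n = a + a

  lower< : ∀ {k} → k < a → k < n
  lower< k<a = <-≤-trans k<a (m≤m+n a a)

  upper< : ∀ {k} → k < a → a + k < n
  upper< = +-monoʳ-< a

  mod-lower-next : ∀ {k} → k < m → (k + 1) mod n ≡ suc k
  mod-lower-next k<m = mod-id (+-comm _ 1) (lower< (s<s k<m))

  mod-upper-next : ∀ {k} → k < m → (a + k + 1) mod n ≡ a + suc k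
  mod-upper-next {k} k<m = mod-id (trans (+-assoc a k 1) (cong (a +_) (+-comm k 1))) (upper< (s<s k<m))

  mod-lower-rung : ∀ {k} → k < a → (k + a) mod n ≡ a + k
  mod-lower-rung {k} k<a = mod-id (+-comm k a) (upper< k<a)

  mod-upper-rung : ∀ {k} → k < a → (a + k + a) mod n ≡ k
  mod-upper-rung {k} k<a = mod-wrap (trans (cong (_+ a) (+-comm a k)) (+-assoc k a a)) (lower< k<a)

  mod-twist₁ : (m + 1) mod n ≡ a + 0
  mod-twist₁ = mod-id (trans (+-comm m 1) (sym (+-identityʳ a))) (upper< z<s)

  mod-twist₂ : (a + m + 1) mod n ≡ 0
  mod-twist₂ = mod-wrap (trans (+-assoc a m 1) (cong (a +_) (+-comm m 1))) z<s

  lowerRail upperRail : Subset n → ℕ → Bool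
  lowerRail S k = S ‼ k
  upperRail S k = S ‼ (a + k)

  independent⇒möbius : ∀ S → IsIndependent n a S → MöbiusIndependent m (lowerRail S) (upperRail S)
  independent⇒möbius S ind = record
    { lower-path = λ i i<m → apart i (suc i) (inj₁ (sym (mod-lower-next i<m)))
    ; upper-path = λ i i<m → apart (a + i) (a + suc i) (inj₁ (sym (mod-upper-next i<m)))
    ; rung       = λ k k<a → apart k (a + k) (inj₂ (sym (mod-lower-rung k<a)))
    ; twist₁     = apart m (a + 0) (inj₁ (sym mod-twist₁))
    ; twist₂     = apart (a + m) 0 (inj₁ (sym mod-twist₂))
    }
    where apart = independent⇒apart ind

  möbius⇒independent : ∀ S → MöbiusIndependent m (lowerRail S) (upperRail S) → IsIndependent n a S
  möbius⇒independent S ind = apart⇒independent apart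
    where
    open MöbiusIndependent ind

    via : ∀ {i j j′} → j ≡ j′ → S ‼ i ∧ S ‼ j′ ≡ false → S ‼ i ∧ S ‼ j ≡ false
    via refl i∧j′ = i∧j′

    apart : ∀ {i j} → i < n → Step n a i j → S ‼ i ∧ S ‼ j ≡ false
    apart i<n step with railPosition {a} i<n
    apart {k} _ (inj₁ j≡) | lower k<a with m<1+n⇒m<n∨m≡n k<a
    ... | inj₁ k<m = via (trans j≡ (mod-lower-next k<m)) (lower-path k k<m)
    ... | inj₂ refl = via (trans j≡ mod-twist₁) twist₁
    apart {k} _ (inj₂ j≡) | lower k<a = via (trans j≡ (mod-lower-rung k<a)) (rung k k<a)
    apart _ (inj₁ j≡) | upper {k} k<a with m<1+n⇒m<n∨m≡n k<a
    ... | inj₁ k<m = via (trans j≡ (mod-upper-next k<m)) (upper-path k k<m)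
    ... | inj₂ refl = via (trans j≡ mod-twist₂) twist₂
    apart _ (inj₂ j≡) | upper {k} k<a =
      via (trans j≡ (mod-upper-rung k<a)) (trans (∧-comm (S ‼ (a + k)) (S ‼ k)) (rung k k<a))

  ∣∣≡rails : ∀ S → ∣ S ∣ ≡ count (lowerRail S) a + count (upperRail S) a
  ∣∣≡rails S = trans (∣∣≡count S) (count-+ (S ‼_) a a)

  independent-size≤ : ∀ S → IsIndependent n a S → ∣ S ∣ ≤ a
  independent-size≤ S ind =
    subst (_≤ a) (sym (∣∣≡rails S)) (rails-count≤ (independent⇒möbius S ind))

  perfect-independent⇒odd : ∀ S → IsIndependent n a S → ∣ S ∣ ≡ a → parity a ≡ true
  perfect-independent⇒odd S ind size≡a =
    complementary-rails⇒odd ladder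
      (rails-count≡⇒complementary ladder (trans (sym (∣∣≡rails S)) size≡a))
    where ladder = independent⇒möbius S ind

  railsSet : (ℕ → Bool) → (ℕ → Bool) → Subset n
  railsSet g h = tabulate {n = a} (g ∘ toℕ) ++ tabulate {n = a} (h ∘ toℕ)

  lowerRail-railsSet : ∀ g h k → k < a → lowerRail (railsSet g h) k ≡ g k
  lowerRail-railsSet g h k k<a =
    trans (‼-++ˡ (tabulate {n = a} (g ∘ toℕ)) _ k k<a) (‼-tabulate g k k<a)

  upperRail-railsSet : ∀ g h k → k < a → upperRail (railsSet g h) k ≡ h k
  upperRail-railsSet g h k k<a =
    trans (‼-++ʳ (tabulate {n = a} (g ∘ toℕ)) _ k) (‼-tabulate h k k<a)

  railsSet-independent : ∀ {g h} → MöbiusIndependent m g h → IsIndependent n a (railsSet g h)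
  railsSet-independent {g} {h} ind = möbius⇒independent (railsSet g h)
    (möbius-cong (λ k k<a → sym (lowerRail-railsSet g h k k<a))
                 (λ k k<a → sym (upperRail-railsSet g h k k<a)) ind)

  ∣railsSet∣ : ∀ g h → ∣ railsSet g h ∣ ≡ count g a + count h a
  ∣railsSet∣ g h = trans (∣∣≡rails (railsSet g h))
    (cong₂ _+_ (count-cong a (lowerRail-railsSet g h)) (count-cong a (upperRail-railsSet g h)))

  odd-independenceNumber : parity a ≡ true → IndependenceNumber n a a
  odd-independenceNumber a-odd =
      ( railsSet parity (not ∘ parity)
      , railsSet-independent (alternating-rails a-odd)
      , trans (∣railsSet∣ parity (not ∘ parity)) (count-not parity a))
    , independent-size≤

  even-independenceNumber : parity a ≡ false → IndependenceNumber n a m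
  even-independenceNumber a-even =
      ( railsSet parity positiveEven
      , railsSet-independent positiveEven-rails
      , trans (∣railsSet∣ parity positiveEven) (count-parity-positiveEven m))
    , size≤m
    where
    size≤m : ∀ S → IsIndependent n a S → ∣ S ∣ ≤ m
    size≤m S ind with m≤n⇒m<n∨m≡n (independent-size≤ S ind)
    ... | inj₁ size<a = s≤s⁻¹ size<a
    ... | inj₂ size≡a with trans (sym a-even) (perfect-independent⇒odd S ind size≡a)
    ...   | ()

lemma3 : (a : ℕ) → 2 ≤ a →
           (a % 2 ≡ 1 → IndependenceNumber (2 * a) a a)
           × (a % 2 ≡ 0 → IndependenceNumber (2 * a) a (a ∸ 1))
lemma3 zero ()
lemma3 (suc m) _ =
    (λ a-odd → subst (λ N → IndependenceNumber N (suc m) (suc m)) a+a≡2a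
                 (odd-independenceNumber m (parity-of a-odd)))
  , (λ a-even → subst (λ N → IndependenceNumber N (suc m) m) a+a≡2a
                  (even-independenceNumber m (parity-of a-even)))
  where
  a+a≡2a : suc m + suc m ≡ 2 * suc m
  a+a≡2a = cong (suc m +_) (sym (+-identityʳ (suc m)))

  parity-of : ∀ {r} → suc m % 2 ≡ r → parity (suc m) ≡ parity r
  parity-of a%2≡r = trans (parity-%2 (suc m)) (cong parity a%2≡r)
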